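{- Let $(\Gamma,\tau)$ and $(\Gamma',\tau')$ be $z$-homogeneous triangulations of connected closed surfaces $M,M'$, let $P$ and $P'$ be special pairs in $\Gamma$ and $\Gamma'$ satisfying condition $(*)$, with $z$-monodromies $M_P$ (a permutation of $\omega(F_P)$) and $M_{P'}$ (a permutation of $\omega(F_{P'})$), and let $g:\partial F_P\to\partial F_{P'}$ be a special homeomorphism, regarded also as the induced bijection $\omega(F_P)\to\omega(F_{P'})$. Then the number of zigzags (up to reversing) of $\Gamma\#_g\Gamma'$ passing through the edges of $g(\omega(F_P))=\omega(F_{P'})$ equals the number of cycles (fixed points counted as 1-cycles) of the permutation $g^{ -1}M_{P'}gM_P$ of $\omega(F_P)$ (composition right to left).
   Context: Surfaces are connected closed 2-dimensional (not necessarily orientable). An embedded graph is a closed 2-cell embedding of a connected finite graph in a surface with no vertices of degree 2; a triangulation is such an embedding of a simple graph with all faces triangles. Two distinct edges are adjacent if they share a vertex and lie in a common face. A zigzag is a cyclic sequence of edges $\{e_i\}$ with $e_i,e_{i+1}$ adjacent, the faces containing $e_i,e_{i+1}$ and $e_{i+1},e_{i+2}$ distinct, and $e_i,e_{i+2}$ without common vertex; $Z^{ -1}$ denotes the reversed sequence. A $z$-orientation $\tau$ contains exactly one of $Z,Z^{ -1}$ for every zigzag $Z$. Each edge is traversed twice by zigzags of $\tau$: it is of type I if in opposite directions, of type II if in the same direction (then $\tau$ directs it). $(\Gamma,\tau)$ is $z$-homogeneous if every face has two edges of type I and one of type II, and every zigzag of $\tau$ is a cyclic sequence $\{e_i,e'_i,e''_i\}_{i=1}^n$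 with $e_i$ of type II and $e'_i,e''_i$ of type I. A special pair $P$ is a directed path $e_1=v_1v_2$, $e_2=v_2v_3$ of two type II edges (directed by $\tau$). Let $F_i^\pm$ be the faces containing $e_i$, labelled so that $F_1^\delta,F_2^\delta$ are on the same side of $P$. Splitting $v_2$ into $v_2^\pm$ and $e_i$ into $e_i^\pm$ (directed as $e_i$, $e_1^\delta=v_1v_2^\delta$, $e_2^\delta=v_2^\delta v_3$, $e_i^\delta\subset F_i^\delta$) yields an embedded graph $N_P(\Gamma)$ with a new 4-gonal face $F_P$; $\omega(F_P)=\{e_1^+,e_2^+,e_1^-,e_2^-\}$. For a face $F$ with consecutive vertices $x_1,\dots,x_k$ let $\Omega(F)$ be its $2k$ directed edges and $D_F$ the permutation of $\Omega(F)$ sending $xx'$ to $x'x''$ for consecutive vertices $x,x',x''$ of $F$. The $z$-monodromy $M_F$: for $e\in\Omega(F)$ take $e_0$ with $D_F(e_0)=e$ and the zigzag containing $e_0,e$ consecutively; $M_F(e)$ is the first element of $\Omega(F)$ in this zigzag after $e$. The $z$-monodromy $M_P$ of $P$ is the restriction of $M_{F_P}$ (in $N_P(\Gamma)$) to $\omega(F_P)$, which is a permutation of $\omega(F_P)$. Condition $(*)$: for at least one of $P,P'$ there is no edge (in $\Gamma$, resp. $\Gamma'$) joining its endpoints $v_1,v_3$. A special homeomorphism $g:\partial F_P\to\partial F_{P'}$ is a homeomorphism sending vertices to vertices and the directed edges of $\omega(F_P)$ onto the directed edges of $\omega(F_{P'})$, preserving directions. $\Gamma\#_g\Gamma'$ is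 the triangulation of $M\#M'$ obtained by removing the interiors of $F_P$ and $F_{P'}$ and gluing their boundaries via $g$. -}

module Defs where

open import Data.Nat using (ℕ; zero; suc; _<_; _≤_)
open import Data.Bool using (Bool; true; false; not; if_then_else_)
open import Data.List using (List; []; _∷_; length)
open import Data.Bool.ListAction using (any)
open import Data.Maybe using (Maybe; just; nothing)
open import Data.Product using (Σ; ∃-syntax; _×_; _,_)
open import Data.Sum using (_⊎_; inj₁; inj₂)
open import Relation.Nullary using (¬_; Dec; yes; no; does)
open import Relation.Binary.PropositionalEquality using (_≡_; refl; cong)
open import Relation.Binary.Definitions using (DecidableEquality)
open import Relation.Binary.Construct.Closure.ReflexiveTransitive using (Star)
open import Data.List.Membership.Propositional using (_∈_)
open import Data.List.Relation.Unary.All using (All)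
open import Data.List.Relation.Unary.Any using (Any)
open import Data.List.Relation.Unary.AllPairs using (AllPairs)

iter : {A : Set} → (A → A) → ℕ → A → A
iter f zero    x = x
iter f (suc n) x = f (iter f n x)

-- Embedded graphs in closed surfaces are encoded by graph-encoded maps
-- (gems / flag systems).  A flag is an incident triple
-- (vertex, edge, face), i.e. a triangle of the barycentric subdivision;
-- s₀ changes the vertex, s₁ the edge, s₂ the face.

record PreGem : Set₁ where
  field
    Flag : Set
    _≟_  : DecidableEquality Flag
    s₀ s₁ s₂ : Flag → Flag

module _ (G : PreGem) where
  open PreGem G

  SameVertex : Flag → Flag → Set
  SameVertex = Star (λ x y → y ≡ s₁ x ⊎ y ≡ s₂ x)

  SameEdge : Flag → Flag → Set
  SameEdge = Star (λ x y → y ≡ s₀ x ⊎ y ≡ s₂ x)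

  Connected : Set
  Connected = ∀ x y → Star (λ u v → v ≡ s₀ u ⊎ v ≡ s₁ u ⊎ v ≡ s₂ u) x y

  -- a finite connected graph 2-cell embedded in a closed connected surface
  record IsGem : Set where
    field
      inv₀ : ∀ x → s₀ (s₀ x) ≡ x
      inv₁ : ∀ x → s₁ (s₁ x) ≡ x
      inv₂ : ∀ x → s₂ (s₂ x) ≡ x
      fpf₀ : ∀ x → ¬ s₀ x ≡ x
      fpf₁ : ∀ x → ¬ s₁ x ≡ x
      fpf₂ : ∀ x → ¬ s₂ x ≡ x
      comm₀₂ : ∀ x → s₀ (s₂ x) ≡ s₂ (s₀ x)
      fpf₀₂ : ∀ x → ¬ s₀ (s₂ x) ≡ x
      finite : Σ (List Flag) (λ l → ∀ x → x ∈ l)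
      connected : Connected

  record IsTriangulation : Set where
    field
      isGem : IsGem
      triangleFaces : ∀ x → iter (λ y → s₀ (s₁ y)) 3 x ≡ x
      noLoops : ∀ x → ¬ SameVertex x (s₀ x)
      noMultiEdges : ∀ x y → SameVertex x y → SameVertex (s₀ x) (s₀ y) → SameEdge x y
      noDegree2 : ∀ x → ¬ iter (λ y → s₁ (s₂ y)) 2 x ≡ x

  -- A flag (v,e,F) is read as the state "traversing e starting
  -- at v, next turning inside F".  ρ is one step of a zigzag (Petrie walk);
  -- a directed zigzag is a ρ-orbit, and t x is the reversed state, so the
  -- ρ-orbit of t x is the reversed zigzag.

  ρ : Flag → Flag
  ρ x = s₂ (s₁ (s₀ x))

  rev : Flag → Flag
  rev x = s₀ (s₂ x)

  SameZigzag : Flag → Flag → Set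
  SameZigzag x y = ∃[ n ] (iter ρ n x ≡ y ⊎ iter ρ n (rev x) ≡ y)

  PassesThrough : (Flag → Set) → Flag → Set
  PassesThrough S x = ∃[ y ] (SameZigzag x y × S y)

  record HasZigzagCount (S : Flag → Set) (c : ℕ) : Set where
    field
      reps : List Flag
      len : length reps ≡ c
      pass : All (PassesThrough S) reps
      distinct : AllPairs (λ x y → ¬ SameZigzag x y) reps
      cover : ∀ x → PassesThrough S x → Any (λ r → SameZigzag r x) reps

  -- z-orientations: τ x ≡ true means the directed zigzag through the
  -- state x belongs to τ.  It is a union of ρ-orbits containing exactly
  -- one of Z, Z⁻¹ for every zigzag Z.

  module _ (τ : Flag → Bool) where
    T : Flag → Set
    T x = τ x ≡ true

    record IsZOrientation : Set where
      field
        ρ-closed : ∀ x → τ (ρ x) ≡ τ x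
        exactlyOne : ∀ x → τ (rev x) ≡ not (τ x)

    -- The τ-traversals of the edge of x are one of {x, rev x} and one of
    -- {s₀ x, s₂ x}; x, s₂ x start at the vertex of x, s₀ x, rev x at the
    -- other endpoint.
    -- type II: both traversals in the same direction
    TypeII : Flag → Set
    TypeII x = (T x × T (s₂ x)) ⊎ (T (s₀ x) × T (s₀ (s₂ x)))

    -- type I: traversals in opposite directions
    TypeI : Flag → Set
    TypeI x = (T x × T (s₀ x)) ⊎ (T (s₂ x) × T (s₀ (s₂ x)))

    OneIITwoI : Flag → Flag → Flag → Set
    OneIITwoI x y z = (TypeII x × TypeI y × TypeI z)
                    ⊎ (TypeI x × TypeII y × TypeI z)
                    ⊎ (TypeI x × TypeI y × TypeII z)

    record IsZHomogeneous : Set where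
      field
        zOrientation : IsZOrientation
        -- the three edges of the face of x: edges of x, s₁ x, s₁ (s₀ x)
        faces : ∀ x → OneIITwoI x (s₁ x) (s₁ (s₀ x))
        -- along every zigzag of τ the types are II, I, I, II, I, I, ...
        zigzags : ∀ x → T x → OneIITwoI x (ρ x) (ρ (ρ x))

    -- Special pair e₁ = v₁v₂, e₂ = v₂v₃ (both type II, directed by τ).
    -- a = (v₂, e₁, F₁⁺);  b = (v₂, e₂, F₂⁺) is the first flag of e₂ met when
    -- turning around v₂ from a starting with s₁, so F₁⁺, F₂⁺ lie on the
    -- same side of P.

    record SpecialPair : Set where
      field
        a b : Flag
        k : ℕ
        walk : b ≡ iter (λ y → s₁ (s₂ y)) k (s₁ a)
        first : ∀ j → j < k → ¬ SameEdge (iter (λ y → s₁ (s₂ y)) j (s₁ a)) b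
        distinctEdges : ¬ SameEdge a b
        -- both τ-traversals of e₁ go from v₁ to v₂
        e₁-directed : T (s₀ a) × T (s₀ (s₂ a))
        -- both τ-traversals of e₂ go from v₂ to v₃
        e₂-directed : T b × T (s₂ b)

    -- no edge joins v₁ = vertex of s₀ a and v₃ = vertex of s₀ b
    NoEdgeJoiningEnds : SpecialPair → Set
    NoEdgeJoiningEnds P = ¬ (∃[ f ] (SameVertex f (s₀ a) × SameVertex (s₀ f) (s₀ b)))
      where open SpecialPair P

data EIdx : Set where
  ι₁ ι₂ : EIdx

data Side : Set where
  pos neg : Side

data End : Set where
  tl hd : End

-- ω(F_P) = { e₁⁺, e₂⁺, e₁⁻, e₂⁻ } (directed edges)
Dir : Set
Dir = EIdx × Side

-- a flag of F_P : (directed edge e_i^δ, endpoint tail/head)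
Lab : Set
Lab = Dir × End

flipSide : Side → Side
flipSide pos = neg
flipSide neg = pos

flipEnd : End → End
flipEnd tl = hd
flipEnd hd = tl

_≟D_ : DecidableEquality Dir
(ι₁ , pos) ≟D (ι₁ , pos) = yes refl
(ι₁ , neg) ≟D (ι₁ , neg) = yes refl
(ι₂ , pos) ≟D (ι₂ , pos) = yes refl
(ι₂ , neg) ≟D (ι₂ , neg) = yes refl
(ι₁ , pos) ≟D (ι₁ , neg) = no λ ()
(ι₁ , pos) ≟D (ι₂ , _) = no λ ()
(ι₁ , neg) ≟D (ι₁ , pos) = no λ ()
(ι₁ , neg) ≟D (ι₂ , _) = no λ ()
(ι₂ , pos) ≟D (ι₂ , neg) = no λ ()
(ι₂ , pos) ≟D (ι₁ , _) = no λ ()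
(ι₂ , neg) ≟D (ι₂ , pos) = no λ ()
(ι₂ , neg) ≟D (ι₁ , _) = no λ ()

_≟E_ : DecidableEquality End
tl ≟E tl = yes refl
hd ≟E hd = yes refl
tl ≟E hd = no λ ()
hd ≟E tl = no λ ()

_≟L_ : DecidableEquality Lab
(d , x) ≟L (d' , x') with d ≟D d' | x ≟E x'
... | yes refl | yes refl = yes refl
... | no p | _ = no λ { refl → p refl }
... | yes _ | no q = no λ { refl → q refl }

sumDec : {A B : Set} → DecidableEquality A → DecidableEquality B → DecidableEquality (A ⊎ B)
sumDec dA dB (inj₁ x) (inj₁ y) with dA x y
... | yes refl = yes refl
... | no p = no λ { refl → p refl }
sumDec dA dB (inj₁ x) (inj₂ y) = no λ ()
sumDec dA dB (inj₂ x) (inj₁ y) = no λ ()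
sumDec dA dB (inj₂ x) (inj₂ y) with dB x y
... | yes refl = yes refl
... | no p = no λ { refl → p refl }

-- The eight flags of Γ on e₁, e₂, labelled by the flag of F_P in N_P(Γ)
-- which is s₂-adjacent to them after splitting.

module _ {G : PreGem} {τ : PreGem.Flag G → Bool} (P : SpecialPair G τ) where
  open PreGem G
  open SpecialPair P

  labelFlag : Lab → Flag
  labelFlag ((ι₁ , pos) , hd) = a
  labelFlag ((ι₁ , neg) , hd) = s₂ a
  labelFlag ((ι₁ , pos) , tl) = s₀ a
  labelFlag ((ι₁ , neg) , tl) = s₀ (s₂ a)
  labelFlag ((ι₂ , pos) , tl) = b
  labelFlag ((ι₂ , neg) , tl) = s₂ b
  labelFlag ((ι₂ , pos) , hd) = s₀ b
  labelFlag ((ι₂ , neg) , hd) = s₀ (s₂ b)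

  allLabs : List Lab
  allLabs = ((ι₁ , pos) , hd) ∷ ((ι₁ , neg) , hd) ∷ ((ι₁ , pos) , tl) ∷ ((ι₁ , neg) , tl)
          ∷ ((ι₂ , pos) , tl) ∷ ((ι₂ , neg) , tl) ∷ ((ι₂ , pos) , hd) ∷ ((ι₂ , neg) , hd) ∷ []

  private
    search : Flag → List Lab → Maybe Lab
    search x [] = nothing
    search x (l ∷ ls) = if does (x ≟ labelFlag l) then just l else search x ls

  oldLabel : Flag → Maybe Lab
  oldLabel x = search x allLabs

  -- N_P(Γ): flags of Γ plus the eight flags of the new face F_P.
  -- The flag (e_i^δ, end) of F_P has vertex the tail/head of e_i^δ,
  -- where e₁^δ = v₁ v₂^δ and e₂^δ = v₂^δ v₃.

  NPs₁ : Lab → Lab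
  NPs₁ ((ι₁ , δ) , tl) = ((ι₁ , flipSide δ) , tl)
  NPs₁ ((ι₁ , δ) , hd) = ((ι₂ , δ) , tl)
  NPs₁ ((ι₂ , δ) , tl) = ((ι₁ , δ) , hd)
  NPs₁ ((ι₂ , δ) , hd) = ((ι₂ , flipSide δ) , hd)

  NP : PreGem
  NP = record
    { Flag = Flag ⊎ Lab
    ; _≟_ = sumDec _≟_ _≟L_
    ; s₀ = λ { (inj₁ x) → inj₁ (s₀ x) ; (inj₂ (d , e)) → inj₂ (d , flipEnd e) }
    ; s₁ = λ { (inj₁ x) → inj₁ (s₁ x) ; (inj₂ l) → inj₂ (NPs₁ l) }
    ; s₂ = λ { (inj₁ x) → s₂old x (oldLabel x) ; (inj₂ l) → inj₁ (labelFlag l) }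
    }
    where
      s₂old : Flag → Maybe Lab → Flag ⊎ Lab
      s₂old x (just l) = inj₂ l
      s₂old x nothing = inj₁ (s₂ x)

  labelOf : PreGem.Flag NP → Maybe Lab
  labelOf (inj₁ x) = oldLabel x
  labelOf (inj₂ l) = just l

  -- For d ∈ ω(F_P) with tail x', the zigzag containing e₀, d consecutively
  -- (D_F(e₀) = d) is the ρ-orbit of the state φ = s₂(x', d, F_P); M_P(d) is
  -- the directed edge traversed at the first later state on ∂F_P
  -- (a state with label (d', tl) traverses d' in its direction).
  IsZMonodromy : (Dir → Dir) → Set
  IsZMonodromy m = ∀ d →
    let φ = PreGem.s₂ NP (inj₂ (d , tl)) in
    ∃[ n ] (1 ≤ n
           × labelOf (iter (ρ NP) n φ) ≡ just (m d , tl)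
           × (∀ j → 1 ≤ j → j < n → labelOf (iter (ρ NP) j φ) ≡ nothing))

-- Special homeomorphisms ∂F_P → ∂F_P'.  ∂F_P is the 4-cycle with vertices
-- v₁, v₂⁺, v₃, v₂⁻ and directed edges e₁^δ = v₁ v₂^δ, e₂^δ = v₂^δ v₃.

data BV : Set where
  w₁ : BV
  w₂ : Side → BV
  w₃ : BV

tailV headV : Dir → BV
tailV (ι₁ , δ) = w₁
tailV (ι₂ , δ) = w₂ δ
headV (ι₁ , δ) = w₂ δ
headV (ι₂ , δ) = w₃

record SpecialHom : Set where
  field
    vmap vmap⁻ : BV → BV
    vmap-inv₁ : ∀ v → vmap⁻ (vmap v) ≡ v
    vmap-inv₂ : ∀ v → vmap (vmap⁻ v) ≡ v
    emap emap⁻ : Dir → Dir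
    emap-inv₁ : ∀ d → emap⁻ (emap d) ≡ d
    emap-inv₂ : ∀ d → emap (emap⁻ d) ≡ d
    tail-pres : ∀ d → vmap (tailV d) ≡ tailV (emap d)
    head-pres : ∀ d → vmap (headV d) ≡ headV (emap d)

-- Γ #_g Γ': flags of Γ and Γ' (those of F_P, F_P' removed); the flag of Γ
-- next to the flag (d, end) of F_P becomes s₂-adjacent to the flag of Γ'
-- next to the flag (g d, end) of F_P'.

module _ {G G' : PreGem} {τ : PreGem.Flag G → Bool} {τ' : PreGem.Flag G' → Bool}
         (P : SpecialPair G τ) (P' : SpecialPair G' τ') (g : SpecialHom) where
  private
    module A = PreGem G
    module B = PreGem G'
  open SpecialHom g

  private
    glue₁ : A.Flag → Maybe Lab → A.Flag ⊎ B.Flag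
    glue₁ x (just (d , e)) = inj₂ (labelFlag P' (emap d , e))
    glue₁ x nothing = inj₁ (A.s₂ x)

    glue₂ : B.Flag → Maybe Lab → A.Flag ⊎ B.Flag
    glue₂ y (just (d , e)) = inj₁ (labelFlag P (emap⁻ d , e))
    glue₂ y nothing = inj₂ (B.s₂ y)

  ConnSum : PreGem
  ConnSum = record
    { Flag = A.Flag ⊎ B.Flag
    ; _≟_ = sumDec A._≟_ B._≟_
    ; s₀ = λ { (inj₁ x) → inj₁ (A.s₀ x) ; (inj₂ y) → inj₂ (B.s₀ y) }
    ; s₁ = λ { (inj₁ x) → inj₁ (A.s₁ x) ; (inj₂ y) → inj₂ (B.s₁ y) }
    ; s₂ = λ { (inj₁ x) → glue₁ x (oldLabel P x) ; (inj₂ y) → glue₂ y (oldLabel P' y) }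
    }

  OnGluedEdges : PreGem.Flag ConnSum → Set
  OnGluedEdges (inj₁ x) = ¬ oldLabel P x ≡ nothing
  OnGluedEdges (inj₂ y) = ¬ oldLabel P' y ≡ nothing

allDirs : List Dir
allDirs = (ι₁ , pos) ∷ (ι₂ , pos) ∷ (ι₁ , neg) ∷ (ι₂ , neg) ∷ []

-- y lies in the cycle of x (cycle length ≤ 4)
sameCycle : (Dir → Dir) → Dir → Dir → Bool
sameCycle π x y = any (λ j → does (iter π j x ≟D y)) (0 ∷ 1 ∷ 2 ∷ 3 ∷ [])

private
  countCycles : (Dir → Dir) → List Dir → List Dir → ℕ
  countCycles π [] seen = 0
  countCycles π (x ∷ xs) seen =
    if any (λ r → sameCycle π r x) seen
    then countCycles π xs seen
    else suc (countCycles π xs (x ∷ seen))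

numCycles : (Dir → Dir) → ℕ
numCycles π = countCycles π allDirs []

-- Follow the zigzag of Γ #_g Γ′ leaving ∂F_P along d ∈ ω(F_P). Until it meets a glued edge again
-- it is the zigzag of N_P(Γ) through d, so it next runs along g (M_P d), now in Γ′; by the same
-- argument in Γ′ (the connected sum is symmetric) it comes back along π d := g⁻¹ (M_P′ (g (M_P d))).
-- These zigzags traverse glued edges only in their own direction, so none is the reverse of another,
-- and π is their first-return map to ω(F_P): two directed glued edges lie on a common zigzag iff they
-- lie in a common π-cycle. Every zigzag through a glued edge is, up to reversing, of this kind.

module Submission where

open import Defs
open import Data.Bool using (Bool; true; false; if_then_else_)
import Data.Bool as 𝔹
open import Data.Bool.ListAction using (any)
open import Data.Empty using (⊥-elim)
open import Data.Fin using (Fin; toℕ) renaming (zero to fz; suc to fs)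
open import Data.Fin.Properties using (pigeonhole; toℕ<n)
open import Data.List using (List; []; _∷_; length; map; upTo)
open import Data.List.Properties using (length-map)
open import Data.List.Membership.Propositional using (_∈_; lose)
open import Data.List.Membership.Propositional.Properties using (∈-upTo⁺)
open import Data.List.Relation.Unary.All as All using (All; []; _∷_)
import Data.List.Relation.Unary.All.Properties as Allₚ
open import Data.List.Relation.Unary.AllPairs as AllPairs using (AllPairs; []; _∷_)
import Data.List.Relation.Unary.AllPairs.Properties as AllPairsₚ
open import Data.List.Relation.Unary.Any as Any using (Any; here; there)
import Data.List.Relation.Unary.Any.Properties as Anyₚ
open import Data.Maybe using (Maybe; just; nothing)
open import Data.Nat using (ℕ; zero; suc; _+_; _*_; _∸_; _<_; _≤_; z≤n; s≤s)
open import Data.Nat.Properties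
  using ( ≤-refl; ≤-trans; ≤-pred; ≤-total; <⇒≤; n<1+n; n≤1+n; m≤n+m; <-cmp; m≤n⇒m<n∨m≡n
        ; +-assoc; +-comm; *-suc; +-mono-≤; +-cancelʳ-<
        ; m+[n∸m]≡n; m∸n+n≡m; m∸n≤m; m<n⇒0<n∸m; ∸-monoʳ-< )
open import Data.Product using (∃-syntax; _×_; _,_; proj₁; proj₂)
open import Data.Sum using (_⊎_; inj₁; inj₂; swap)
open import Data.Sum.Properties using (inj₁-injective; inj₂-injective)
open import Function using (_∘_)
open import Function.Definitions using (Injective)
open import Relation.Binary.Construct.Closure.ReflexiveTransitive using (ε; _◅_; _◅◅_)
open import Relation.Binary.Definitions using (tri<; tri≈; tri>)
open import Relation.Binary.PropositionalEquality
open import Relation.Nullary using (¬_; yes; no; does)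
open import Relation.Nullary.Decidable using (toWitness; fromWitness; isYes≗does)

iter-+ : {A : Set} (f : A → A) (m n : ℕ) (x : A) → iter f (m + n) x ≡ iter f m (iter f n x)
iter-+ f zero    n x = refl
iter-+ f (suc m) n x = cong f (iter-+ f m n x)

iter-sucʳ : {A : Set} (f : A → A) (n : ℕ) (x : A) → iter f (suc n) x ≡ iter f n (f x)
iter-sucʳ f zero    x = refl
iter-sucʳ f (suc n) x = cong f (iter-sucʳ f n x)

iter-injective : {A : Set} {f : A → A} → Injective _≡_ _≡_ f →
                 ∀ n {x y} → iter f n x ≡ iter f n y → x ≡ y
iter-injective f-inj zero    eq = eq
iter-injective f-inj (suc n) eq = iter-injective f-inj n (f-inj eq)

iter-concat : {A : Set} (f : A → A) {Q : A → Set} {x y : A} (n n′ : ℕ) →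
              iter f n x ≡ y → Q y →
              (∀ j → 1 ≤ j → j < n → Q (iter f j x)) → (∀ j → 1 ≤ j → j < n′ → Q (iter f j y)) →
              ∀ j → 1 ≤ j → j < n′ + n → Q (iter f j x)
iter-concat f {Q} {x} {y} n n′ reach Qy before after j 1≤j j<n′+n with <-cmp j n
... | tri< j<n _ _    = before j 1≤j j<n
... | tri≈ _ refl _   = subst Q (sym reach) Qy
... | tri> _ _ n<j    = subst Q shifted (after (j ∸ n) (m<n⇒0<n∸m n<j) (+-cancelʳ-< _ _ _ j∸n+n<n′+n))
  where
  j∸n+n≡j : j ∸ n + n ≡ j
  j∸n+n≡j = m∸n+n≡m (<⇒≤ n<j)
  j∸n+n<n′+n : j ∸ n + n < n′ + n
  j∸n+n<n′+n = subst (_< n′ + n) (sym j∸n+n≡j) j<n′+n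
  shifted : iter f (j ∸ n) y ≡ iter f j x
  shifted = trans (cong (iter f (j ∸ n)) (sym reach))
                  (trans (sym (iter-+ f (j ∸ n) n x)) (cong (λ k → iter f k x) j∸n+n≡j))

module ReversibleDynamics {X : Set} (σ rev : X → X) (σ-injective : Injective _≡_ _≡_ σ)
                          (rev-involutive : ∀ x → rev (rev x) ≡ x)
                          (σ-rev-σ : ∀ x → σ (rev (σ x)) ≡ rev x) where
  open ≡-Reasoning

  iter-rev-iter : ∀ n x → iter σ n (rev (iter σ n x)) ≡ rev x
  iter-rev-iter zero    x = refl
  iter-rev-iter (suc n) x = begin
    iter σ (suc n) (rev (σ (iter σ n x))) ≡⟨ iter-sucʳ σ n _ ⟩
    iter σ n (σ (rev (σ (iter σ n x))))   ≡⟨ cong (iter σ n) (σ-rev-σ (iter σ n x)) ⟩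
    iter σ n (rev (iter σ n x))           ≡⟨ iter-rev-iter n x ⟩
    rev x                                 ∎

  Orbit : X → X → Set
  Orbit z y = ∃[ m ] (iter σ m z ≡ y)

  SameOrbitUpToRev : X → X → Set
  SameOrbitUpToRev z x = ∃[ n ] (iter σ n z ≡ x ⊎ iter σ n (rev z) ≡ x)

  Periodic : X → Set
  Periodic z = ∃[ n ] (iter σ (suc n) z ≡ z)

  iter-multiple-period : ∀ {z n} → iter σ (suc n) z ≡ z → ∀ k → iter σ (k * suc n) z ≡ z
  iter-multiple-period period zero = refl
  iter-multiple-period {z} {n} period (suc k) = begin
    iter σ (suc n + k * suc n) z      ≡⟨ iter-+ σ (suc n) (k * suc n) z ⟩
    iter σ (suc n) (iter σ (k * suc n) z) ≡⟨ cong (iter σ (suc n)) (iter-multiple-period period k) ⟩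
    iter σ (suc n) z                  ≡⟨ period ⟩
    z                                 ∎

  orbit-backwards : ∀ {z x} → Periodic z → ∀ n m → iter σ n x ≡ iter σ m z → Orbit z x
  orbit-backwards {z} {x} (p , period) n m eq = m + n * p , iter-injective σ-injective n (begin
    iter σ n (iter σ (m + n * p) z) ≡⟨ iter-+ σ n (m + n * p) z ⟨
    iter σ (n + (m + n * p)) z      ≡⟨ cong (λ k → iter σ k z) reorder ⟩
    iter σ (m + n * suc p) z        ≡⟨ iter-+ σ m (n * suc p) z ⟩
    iter σ m (iter σ (n * suc p) z) ≡⟨ cong (iter σ m) (iter-multiple-period period n) ⟩
    iter σ m z                      ≡⟨ eq ⟨
    iter σ n x                      ∎)
    where
    reorder : n + (m + n * p) ≡ m + n * suc p
    reorder = begin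
      n + (m + n * p) ≡⟨ +-assoc n m (n * p) ⟨
      n + m + n * p   ≡⟨ cong (_+ n * p) (+-comm n m) ⟩
      m + n + n * p   ≡⟨ +-assoc m n (n * p) ⟩
      m + (n + n * p) ≡⟨ cong (m +_) (*-suc n p) ⟨
      m + n * suc p   ∎

  rev-orbit : ∀ {z} → Periodic z → ∀ m → Orbit (rev z) (rev (iter σ m z))
  rev-orbit {z} (p , period) m = m * p , (begin
    iter σ (m * p) (rev z)                          ≡⟨ cong (λ w → iter σ (m * p) (rev w)) returns ⟨
    iter σ (m * p) (rev (iter σ (m * p) (iter σ m z))) ≡⟨ iter-rev-iter (m * p) (iter σ m z) ⟩
    rev (iter σ m z)                                ∎)
    where
    returns : iter σ (m * p) (iter σ m z) ≡ z
    returns = begin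
      iter σ (m * p) (iter σ m z) ≡⟨ iter-+ σ (m * p) m z ⟨
      iter σ (m * p + m) z        ≡⟨ cong (λ k → iter σ k z) (trans (+-comm (m * p) m) (sym (*-suc m p))) ⟩
      iter σ (m * suc p) z        ≡⟨ iter-multiple-period period m ⟩
      z                           ∎

  periodic-rev : ∀ {z} → Periodic z → Periodic (rev z)
  periodic-rev {z} (p , period) =
    p , trans (cong (λ w → iter σ (suc p) (rev w)) (sym period)) (iter-rev-iter (suc p) z)

  sameOrbitUpToRev-periodic : ∀ {z x y} → Periodic z → SameOrbitUpToRev x y →
                              Orbit z y ⊎ Orbit (rev z) y → SameOrbitUpToRev z x
  sameOrbitUpToRev-periodic per (n , inj₁ x→y) (inj₁ (m , z→y))
    with k , z→x ← orbit-backwards per n m (trans x→y (sym z→y)) = k , inj₁ z→x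
  sameOrbitUpToRev-periodic per (n , inj₁ x→y) (inj₂ (m , rz→y))
    with k , rz→x ← orbit-backwards (periodic-rev per) n m (trans x→y (sym rz→y)) = k , inj₂ rz→x
  sameOrbitUpToRev-periodic {x = x} per (n , inj₂ rx→y) (inj₁ (m , z→y))
    with k , z→rx ← orbit-backwards per n m (trans rx→y (sym z→y))
    with k′ , eq ← rev-orbit per k =
    k′ , inj₂ (trans eq (trans (cong rev z→rx) (rev-involutive x)))
  sameOrbitUpToRev-periodic {z} {x} per (n , inj₂ rx→y) (inj₂ (m , rz→y))
    with k , rz→rx ← orbit-backwards (periodic-rev per) n m (trans rx→y (sym rz→y))
    with k′ , eq ← rev-orbit (periodic-rev per) k =
    k′ , inj₁ (trans (cong (iter σ k′) (sym (rev-involutive z)))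
                     (trans eq (trans (cong rev rz→rx) (rev-involutive x))))

  sameOrbitUpToRev-orbit : ∀ {r z x} → Periodic r → Orbit r z → SameOrbitUpToRev z x → SameOrbitUpToRev r x
  sameOrbitUpToRev-orbit {r} per (m , refl) (n , inj₁ z→x) = n + m , inj₁ (trans (iter-+ σ n m r) z→x)
  sameOrbitUpToRev-orbit {r} per (m , refl) (n , inj₂ rz→x) with m′ , eq ← rev-orbit per m =
    n + m′ , inj₂ (trans (iter-+ σ n m′ (rev r)) (trans (cong (iter σ n) eq) rz→x))

dirIndex : Dir → Fin 4
dirIndex (ι₁ , pos) = fz
dirIndex (ι₂ , pos) = fs fz
dirIndex (ι₁ , neg) = fs (fs fz)
dirIndex (ι₂ , neg) = fs (fs (fs fz))

dirOf : Fin 4 → Dir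
dirOf fz                = ι₁ , pos
dirOf (fs fz)           = ι₂ , pos
dirOf (fs (fs fz))      = ι₁ , neg
dirOf (fs (fs (fs fz))) = ι₂ , neg

dirOf-dirIndex : ∀ d → dirOf (dirIndex d) ≡ d
dirOf-dirIndex (ι₁ , pos) = refl
dirOf-dirIndex (ι₂ , pos) = refl
dirOf-dirIndex (ι₁ , neg) = refl
dirOf-dirIndex (ι₂ , neg) = refl

dirIndex-injective : Injective _≡_ _≡_ dirIndex
dirIndex-injective {d} {d′} eq = trans (sym (dirOf-dirIndex d)) (trans (cong dirOf eq) (dirOf-dirIndex d′))

allDirs-complete : ∀ d → d ∈ allDirs
allDirs-complete (ι₁ , pos) = here refl
allDirs-complete (ι₂ , pos) = there (here refl)
allDirs-complete (ι₁ , neg) = there (there (here refl))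
allDirs-complete (ι₂ , neg) = there (there (there (here refl)))

sameCycle-within : ∀ f {j x y} → j < 4 → iter f j x ≡ y → 𝔹.T (sameCycle f x y)
sameCycle-within f {j} {x} {y} j<4 eq =
  Anyₚ.any⁺ (λ i → does (iter f i x ≟D y))
       (lose (∈-upTo⁺ j<4) (subst 𝔹.T (isYes≗does (iter f j x ≟D y)) (fromWitness eq)))

module _ {f : Dir → Dir} (f-inj : Injective _≡_ _≡_ f) where

  iter-period : ∀ d → ∃[ p ] (1 ≤ p × p ≤ 4 × iter f p d ≡ d)
  iter-period d
    with i , j , i<j , eq ← pigeonhole (n<1+n 4) (λ (k : Fin 5) → dirIndex (iter f (toℕ k) d)) =
    toℕ j ∸ toℕ i , m<n⇒0<n∸m i<j , ≤-trans (m∸n≤m (toℕ j) (toℕ i)) (≤-pred (toℕ<n j)) ,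
    iter-injective f-inj (toℕ i) (begin
      iter f (toℕ i) (iter f (toℕ j ∸ toℕ i) d) ≡⟨ iter-+ f (toℕ i) _ d ⟨
      iter f (toℕ i + (toℕ j ∸ toℕ i)) d        ≡⟨ cong (λ k → iter f k d) (m+[n∸m]≡n (<⇒≤ i<j)) ⟩
      iter f (toℕ j) d                          ≡⟨ dirIndex-injective eq ⟨
      iter f (toℕ i) d                          ∎)
    where open ≡-Reasoning

  iter-below-4 : ∀ k d → ∃[ j ] (j < 4 × iter f k d ≡ iter f j d)
  iter-below-4 zero    d = 0 , s≤s z≤n , refl
  iter-below-4 (suc k) d with iter-below-4 k d
  ... | 0 , _ , eq = 1 , s≤s (s≤s z≤n) , cong f eq
  ... | 1 , _ , eq = 2 , s≤s (s≤s (s≤s z≤n)) , cong f eq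
  ... | 2 , _ , eq = 3 , s≤s (s≤s (s≤s (s≤s z≤n))) , cong f eq
  ... | suc (suc (suc (suc _))) , s≤s (s≤s (s≤s (s≤s ()))) , _
  ... | 3 , _ , eq with p , p≥1 , p≤4 , period ← iter-period d =
    4 ∸ p , ∸-monoʳ-< {4} {p} {0} p≥1 p≤4 , (begin
      f (iter f k d)          ≡⟨ cong f eq ⟩
      iter f 4 d              ≡⟨ cong (λ m → iter f m d) (m∸n+n≡m p≤4) ⟨
      iter f (4 ∸ p + p) d    ≡⟨ iter-+ f (4 ∸ p) p d ⟩
      iter f (4 ∸ p) (iter f p d) ≡⟨ cong (iter f (4 ∸ p)) period ⟩
      iter f (4 ∸ p) d        ∎)
    where open ≡-Reasoning

  sameCycle-complete : ∀ k {x y} → iter f k x ≡ y → 𝔹.T (sameCycle f x y)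
  sameCycle-complete k {x} eq with j , j<4 , eq′ ← iter-below-4 k x =
    sameCycle-within f j<4 (trans (sym eq′) eq)

sameCycle-sound : ∀ f {x y} → 𝔹.T (sameCycle f x y) → ∃[ j ] (iter f j x ≡ y)
sameCycle-sound f {x} {y} hit
  with j , found ← Any.satisfied (Anyₚ.any⁻ (λ i → does (iter f i x ≟D y)) (upTo 4) hit) =
  j , toWitness (subst 𝔹.T (sym (isYes≗does (iter f j x ≟D y))) found)

module CycleRepresentatives (π : Dir → Dir) where

  SameCycle : Dir → Dir → Set
  SameCycle x y = 𝔹.T (sameCycle π x y)

  private
    seenCycle : List Dir → Dir → Bool
    seenCycle seen x = any (λ r → sameCycle π r x) seen

  cycleReps : List Dir → List Dir → List Dir
  cycleReps []       seen = []
  cycleReps (x ∷ xs) seen =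
    if seenCycle seen x then cycleReps xs seen else x ∷ cycleReps xs (x ∷ seen)

  -- The private countCycles of Defs, repeated so that numCycles π unfolds to cycleCount allDirs [].
  cycleCount : List Dir → List Dir → ℕ
  cycleCount []       seen = 0
  cycleCount (x ∷ xs) seen =
    if seenCycle seen x then cycleCount xs seen else suc (cycleCount xs (x ∷ seen))

  length-cycleReps : ∀ xs seen → length (cycleReps xs seen) ≡ cycleCount xs seen
  length-cycleReps []       seen = refl
  length-cycleReps (x ∷ xs) seen with seenCycle seen x
  ... | true  = length-cycleReps xs seen
  ... | false = cong suc (length-cycleReps xs (x ∷ seen))

  cycleReps-fresh : ∀ xs seen → All (λ y → All (λ r → ¬ SameCycle r y) seen) (cycleReps xs seen)
  cycleReps-fresh []       seen = []
  cycleReps-fresh (x ∷ xs) seen with seenCycle seen x in unseen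
  ... | true  = cycleReps-fresh xs seen
  ... | false =
    Allₚ.¬Any⇒All¬ seen (λ hit → subst 𝔹.T unseen (Anyₚ.any⁺ (λ r → sameCycle π r x) hit))
    ∷ All.map All.tail (cycleReps-fresh xs (x ∷ seen))

  cycleReps-distinct : ∀ xs seen → AllPairs (λ x y → ¬ SameCycle x y) (cycleReps xs seen)
  cycleReps-distinct []       seen = []
  cycleReps-distinct (x ∷ xs) seen with seenCycle seen x
  ... | true  = cycleReps-distinct xs seen
  ... | false = All.map All.head (cycleReps-fresh xs (x ∷ seen)) ∷ cycleReps-distinct xs (x ∷ seen)

  cycleReps-cover : ∀ xs seen {d} → d ∈ xs →
                    Any (λ r → SameCycle r d) seen ⊎ Any (λ r → SameCycle r d) (cycleReps xs seen)
  cycleReps-cover (x ∷ xs) seen d∈ with seenCycle seen x in found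
  cycleReps-cover (x ∷ xs) seen (here refl) | true =
    inj₁ (Anyₚ.any⁻ (λ r → sameCycle π r x) seen (subst 𝔹.T (sym found) _))
  cycleReps-cover (x ∷ xs) seen (there d∈) | true = cycleReps-cover xs seen d∈
  cycleReps-cover (x ∷ xs) seen (here refl) | false =
    inj₂ (here (sameCycle-within π {0} {x} (s≤s z≤n) refl))
  cycleReps-cover (x ∷ xs) seen (there d∈) | false with cycleReps-cover xs (x ∷ seen) d∈
  ... | inj₁ (here hit)  = inj₂ (here hit)
  ... | inj₁ (there hit) = inj₁ hit
  ... | inj₂ hit         = inj₂ (there hit)

  cycleReps-covers-all : ∀ d → Any (λ r → SameCycle r d) (cycleReps allDirs [])
  cycleReps-covers-all d with cycleReps-cover allDirs [] (allDirs-complete d)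
  ... | inj₂ hit = hit

  length-cycleReps-allDirs : length (cycleReps allDirs []) ≡ numCycles π
  length-cycleReps-allDirs = length-cycleReps allDirs []

module EdgeFlags (G : PreGem) (gem : IsGem G) where
  open PreGem G
  open IsGem gem

  edgeFlag : Flag → Side → Bool → Flag
  edgeFlag x pos false = x
  edgeFlag x neg false = s₂ x
  edgeFlag x pos true  = s₀ x
  edgeFlag x neg true  = s₀ (s₂ x)

  private
    x≢s₂x : ∀ x → ¬ x ≡ s₂ x
    x≢s₂x x eq = fpf₂ x (sym eq)
    x≢s₀x : ∀ x → ¬ x ≡ s₀ x
    x≢s₀x x eq = fpf₀ x (sym eq)
    x≢s₀s₂x : ∀ x → ¬ x ≡ s₀ (s₂ x)
    x≢s₀s₂x x eq = fpf₀₂ x (sym eq)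
    s₂x≢s₀x : ∀ x → ¬ s₂ x ≡ s₀ x
    s₂x≢s₀x x eq = fpf₀₂ x (trans (cong s₀ eq) (inv₀ x))
    s₂x≢s₀s₂x : ∀ x → ¬ s₂ x ≡ s₀ (s₂ x)
    s₂x≢s₀s₂x x eq = fpf₀ (s₂ x) (sym eq)
    s₀x≢s₀s₂x : ∀ x → ¬ s₀ x ≡ s₀ (s₂ x)
    s₀x≢s₀s₂x x eq = x≢s₂x x (trans (sym (inv₀ x)) (trans (cong s₀ eq) (inv₀ (s₂ x))))

  edgeFlag-injective : ∀ x δ β δ′ β′ → edgeFlag x δ β ≡ edgeFlag x δ′ β′ → δ ≡ δ′ × β ≡ β′
  edgeFlag-injective x pos false pos false eq = refl , refl
  edgeFlag-injective x neg false neg false eq = refl , refl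
  edgeFlag-injective x pos true  pos true  eq = refl , refl
  edgeFlag-injective x neg true  neg true  eq = refl , refl
  edgeFlag-injective x pos false neg false eq = ⊥-elim (x≢s₂x x eq)
  edgeFlag-injective x pos false pos true  eq = ⊥-elim (x≢s₀x x eq)
  edgeFlag-injective x pos false neg true  eq = ⊥-elim (x≢s₀s₂x x eq)
  edgeFlag-injective x neg false pos false eq = ⊥-elim (x≢s₂x x (sym eq))
  edgeFlag-injective x neg false pos true  eq = ⊥-elim (s₂x≢s₀x x eq)
  edgeFlag-injective x neg false neg true  eq = ⊥-elim (s₂x≢s₀s₂x x eq)
  edgeFlag-injective x pos true  pos false eq = ⊥-elim (x≢s₀x x (sym eq))
  edgeFlag-injective x pos true  neg false eq = ⊥-elim (s₂x≢s₀x x (sym eq))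
  edgeFlag-injective x pos true  neg true  eq = ⊥-elim (s₀x≢s₀s₂x x eq)
  edgeFlag-injective x neg true  pos false eq = ⊥-elim (x≢s₀s₂x x (sym eq))
  edgeFlag-injective x neg true  neg false eq = ⊥-elim (s₂x≢s₀s₂x x (sym eq))
  edgeFlag-injective x neg true  pos true  eq = ⊥-elim (s₀x≢s₀s₂x x (sym eq))

  sameEdge-edgeFlag : ∀ x δ β → SameEdge G x (edgeFlag x δ β)
  sameEdge-edgeFlag x pos false = ε
  sameEdge-edgeFlag x neg false = inj₂ refl ◅ ε
  sameEdge-edgeFlag x pos true  = inj₁ refl ◅ ε
  sameEdge-edgeFlag x neg true  = inj₂ refl ◅ inj₁ refl ◅ ε

  edgeFlag-sameEdge : ∀ x δ β → SameEdge G (edgeFlag x δ β) x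
  edgeFlag-sameEdge x pos false = ε
  edgeFlag-sameEdge x neg false = inj₂ (sym (inv₂ x)) ◅ ε
  edgeFlag-sameEdge x pos true  = inj₁ (sym (inv₀ x)) ◅ ε
  edgeFlag-sameEdge x neg true  = inj₁ (sym (inv₀ (s₂ x))) ◅ inj₂ (sym (inv₂ x)) ◅ ε

  module Labels {τ : Flag → Bool} (P : SpecialPair G τ) where
    open SpecialPair P

    private
      base : EIdx → Flag
      base ι₁ = a
      base ι₂ = b

      -- a = (v₂, e₁, F₁⁺) is the head end of e₁, b = (v₂, e₂, F₂⁺) the tail end of e₂
      awayFromV₂ : EIdx → End → Bool
      awayFromV₂ ι₁ tl = true
      awayFromV₂ ι₁ hd = false
      awayFromV₂ ι₂ tl = false
      awayFromV₂ ι₂ hd = true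

      awayFromV₂-injective : ∀ i e e′ → awayFromV₂ i e ≡ awayFromV₂ i e′ → e ≡ e′
      awayFromV₂-injective ι₁ tl tl _ = refl
      awayFromV₂-injective ι₁ hd hd _ = refl
      awayFromV₂-injective ι₂ tl tl _ = refl
      awayFromV₂-injective ι₂ hd hd _ = refl
      awayFromV₂-injective ι₁ tl hd ()
      awayFromV₂-injective ι₁ hd tl ()
      awayFromV₂-injective ι₂ tl hd ()
      awayFromV₂-injective ι₂ hd tl ()

      labelFlag-edgeFlag : ∀ i δ e → labelFlag P ((i , δ) , e) ≡ edgeFlag (base i) δ (awayFromV₂ i e)
      labelFlag-edgeFlag ι₁ pos tl = refl
      labelFlag-edgeFlag ι₁ pos hd = refl
      labelFlag-edgeFlag ι₁ neg tl = refl
      labelFlag-edgeFlag ι₁ neg hd = refl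
      labelFlag-edgeFlag ι₂ pos tl = refl
      labelFlag-edgeFlag ι₂ pos hd = refl
      labelFlag-edgeFlag ι₂ neg tl = refl
      labelFlag-edgeFlag ι₂ neg hd = refl

      e₁-flag≢e₂-flag : ∀ δ β δ′ β′ → ¬ edgeFlag a δ β ≡ edgeFlag b δ′ β′
      e₁-flag≢e₂-flag δ β δ′ β′ eq = distinctEdges
        (sameEdge-edgeFlag a δ β ◅◅ subst (λ z → SameEdge G z b) (sym eq) (edgeFlag-sameEdge b δ′ β′))

      sameBase : ∀ i {δ e δ′ e′} →
                 edgeFlag (base i) δ (awayFromV₂ i e) ≡ edgeFlag (base i) δ′ (awayFromV₂ i e′) →
                 ((i , δ) , e) ≡ ((i , δ′) , e′)
      sameBase i {δ} {e} {δ′} {e′} eq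
        with refl , away ← edgeFlag-injective (base i) δ _ δ′ _ eq
        with refl ← awayFromV₂-injective i e e′ away = refl

    labelFlag-injective : ∀ l l′ → labelFlag P l ≡ labelFlag P l′ → l ≡ l′
    labelFlag-injective ((i , δ) , e) ((i′ , δ′) , e′) eq =
      compare i i′ (trans (sym (labelFlag-edgeFlag i δ e)) (trans eq (labelFlag-edgeFlag i′ δ′ e′)))
      where
      compare : ∀ i i′ →
                edgeFlag (base i) δ (awayFromV₂ i e) ≡ edgeFlag (base i′) δ′ (awayFromV₂ i′ e′) →
                ((i , δ) , e) ≡ ((i′ , δ′) , e′)
      compare ι₁ ι₁ eq = sameBase ι₁ eq
      compare ι₂ ι₂ eq = sameBase ι₂ eq
      compare ι₁ ι₂ eq = ⊥-elim (e₁-flag≢e₂-flag δ _ δ′ _ eq)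
      compare ι₂ ι₁ eq = ⊥-elim (e₁-flag≢e₂-flag δ′ _ δ _ (sym eq))

    -- The private search of Defs, repeated so that oldLabel P x unfolds to labelSearch x (allLabs P).
    labelSearch : Flag → List Lab → Maybe Lab
    labelSearch x []       = nothing
    labelSearch x (l ∷ ls) = if does (x ≟ labelFlag P l) then just l else labelSearch x ls

    private
      labelSearch-just : ∀ x ls {l} → labelSearch x ls ≡ just l → x ≡ labelFlag P l
      labelSearch-just x (l′ ∷ ls) found with x ≟ labelFlag P l′
      labelSearch-just x (l′ ∷ ls) refl | yes x≡ = x≡
      ... | no _ = labelSearch-just x ls found

      labelSearch-labelFlag : ∀ l ls → l ∈ ls → labelSearch (labelFlag P l) ls ≡ just l
      labelSearch-labelFlag l (l′ ∷ ls) l∈ with labelFlag P l ≟ labelFlag P l′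
      ... | yes eq = cong just (sym (labelFlag-injective l l′ eq))
      labelSearch-labelFlag l (l′ ∷ ls) (here refl) | no neq = ⊥-elim (neq refl)
      labelSearch-labelFlag l (l′ ∷ ls) (there l∈) | no _ = labelSearch-labelFlag l ls l∈

      allLabs-complete : ∀ l → l ∈ allLabs P
      allLabs-complete ((ι₁ , pos) , hd) = here refl
      allLabs-complete ((ι₁ , neg) , hd) = there (here refl)
      allLabs-complete ((ι₁ , pos) , tl) = there (there (here refl))
      allLabs-complete ((ι₁ , neg) , tl) = there (there (there (here refl)))
      allLabs-complete ((ι₂ , pos) , tl) = there (there (there (there (here refl))))
      allLabs-complete ((ι₂ , neg) , tl) = there (there (there (there (there (here refl)))))
      allLabs-complete ((ι₂ , pos) , hd) = there (there (there (there (there (there (here refl))))))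
      allLabs-complete ((ι₂ , neg) , hd) = there (there (there (there (there (there (there (here refl)))))))

    oldLabel-labelFlag : ∀ l → oldLabel P (labelFlag P l) ≡ just l
    oldLabel-labelFlag l = labelSearch-labelFlag l (allLabs P) (allLabs-complete l)

    oldLabel-just : ∀ x {l} → oldLabel P x ≡ just l → x ≡ labelFlag P l
    oldLabel-just x = labelSearch-just x (allLabs P)

    labelFlag-labelled : ∀ l → ¬ oldLabel P (labelFlag P l) ≡ nothing
    labelFlag-labelled l eq with () ← trans (sym (oldLabel-labelFlag l)) eq

    flipLabelSide : Lab → Lab
    flipLabelSide ((i , δ) , e) = ((i , flipSide δ) , e)

    flipLabelEnd : Lab → Lab
    flipLabelEnd (d , e) = (d , flipEnd e)

    s₂-labelFlag : ∀ l → s₂ (labelFlag P l) ≡ labelFlag P (flipLabelSide l)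
    s₂-labelFlag ((ι₁ , pos) , hd) = refl
    s₂-labelFlag ((ι₁ , neg) , hd) = inv₂ a
    s₂-labelFlag ((ι₁ , pos) , tl) = sym (comm₀₂ a)
    s₂-labelFlag ((ι₁ , neg) , tl) = trans (sym (comm₀₂ (s₂ a))) (cong s₀ (inv₂ a))
    s₂-labelFlag ((ι₂ , pos) , tl) = refl
    s₂-labelFlag ((ι₂ , neg) , tl) = inv₂ b
    s₂-labelFlag ((ι₂ , pos) , hd) = sym (comm₀₂ b)
    s₂-labelFlag ((ι₂ , neg) , hd) = trans (sym (comm₀₂ (s₂ b))) (cong s₀ (inv₂ b))

    s₀-labelFlag : ∀ l → s₀ (labelFlag P l) ≡ labelFlag P (flipLabelEnd l)
    s₀-labelFlag ((ι₁ , pos) , hd) = refl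
    s₀-labelFlag ((ι₁ , neg) , hd) = refl
    s₀-labelFlag ((ι₁ , pos) , tl) = inv₀ a
    s₀-labelFlag ((ι₁ , neg) , tl) = inv₀ (s₂ a)
    s₀-labelFlag ((ι₂ , pos) , tl) = refl
    s₀-labelFlag ((ι₂ , neg) , tl) = refl
    s₀-labelFlag ((ι₂ , pos) , hd) = inv₀ b
    s₀-labelFlag ((ι₂ , neg) , hd) = inv₀ (s₂ b)

    private
      unlabelled-preimage : ∀ (s : Flag → Flag) (flip : Lab → Lab) → (∀ x → s (s x) ≡ x) →
                            (∀ l → s (labelFlag P l) ≡ labelFlag P (flip l)) →
                            ∀ x → oldLabel P x ≡ nothing → oldLabel P (s x) ≡ nothing
      unlabelled-preimage s flip s-inv s-label x unlabelled with oldLabel P (s x) in found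
      ... | nothing = refl
      ... | just l  = ⊥-elim (labelFlag-labelled (flip l) (subst (λ z → oldLabel P z ≡ nothing) x≡ unlabelled))
        where
        x≡ : x ≡ labelFlag P (flip l)
        x≡ = trans (sym (s-inv x)) (trans (cong s (oldLabel-just (s x) found)) (s-label l))

    oldLabel-s₂-nothing : ∀ x → oldLabel P x ≡ nothing → oldLabel P (s₂ x) ≡ nothing
    oldLabel-s₂-nothing = unlabelled-preimage s₂ flipLabelSide inv₂ s₂-labelFlag

    oldLabel-s₀-nothing : ∀ x → oldLabel P x ≡ nothing → oldLabel P (s₀ x) ≡ nothing
    oldLabel-s₀-nothing = unlabelled-preimage s₀ flipLabelEnd inv₀ s₀-labelFlag

module GluedLeft {G G′ : PreGem} {τ : PreGem.Flag G → Bool} {τ′ : PreGem.Flag G′ → Bool}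
                 (gem : IsGem G) (gem′ : IsGem G′)
                 (P : SpecialPair G τ) (P′ : SpecialPair G′ τ′) (g : SpecialHom) where
  private
    module A = PreGem G
    module B = PreGem G′
    module IA = IsGem gem
    module LA = EdgeFlags.Labels G gem P
    module LB = EdgeFlags.Labels G′ gem′ P′
    module NP = PreGem (NP P)
  open SpecialHom g
  open PreGem (ConnSum P P′ g) public

  Γ#Γ′ : PreGem
  Γ#Γ′ = ConnSum P P′ g

  s₂-labelled : ∀ x {d e} → oldLabel P x ≡ just (d , e) → s₂ (inj₁ x) ≡ inj₂ (labelFlag P′ (emap d , e))
  s₂-labelled x eq rewrite eq = refl

  s₂-unlabelled : ∀ x → oldLabel P x ≡ nothing → s₂ (inj₁ x) ≡ inj₁ (A.s₂ x)
  s₂-unlabelled x eq rewrite eq = refl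

  s₂-labelledʳ : ∀ y {d e} → oldLabel P′ y ≡ just (d , e) → s₂ (inj₂ y) ≡ inj₁ (labelFlag P (emap⁻ d , e))
  s₂-labelledʳ y eq rewrite eq = refl

  s₂-involutiveˡ : ∀ x → s₂ (s₂ (inj₁ x)) ≡ inj₁ x
  s₂-involutiveˡ x with oldLabel P x in found
  ... | just (d , e) = begin
    s₂ (inj₂ (labelFlag P′ (emap d , e)))    ≡⟨ s₂-labelledʳ _ (LB.oldLabel-labelFlag (emap d , e)) ⟩
    inj₁ (labelFlag P (emap⁻ (emap d) , e))  ≡⟨ cong (λ d′ → inj₁ (labelFlag P (d′ , e))) (emap-inv₁ d) ⟩
    inj₁ (labelFlag P (d , e))               ≡⟨ cong inj₁ (LA.oldLabel-just x found) ⟨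
    inj₁ x                                   ∎
    where open ≡-Reasoning
  ... | nothing = begin
    s₂ (inj₁ (A.s₂ x))     ≡⟨ s₂-unlabelled (A.s₂ x) (LA.oldLabel-s₂-nothing x found) ⟩
    inj₁ (A.s₂ (A.s₂ x))   ≡⟨ cong inj₁ (IA.inv₂ x) ⟩
    inj₁ x                 ∎
    where open ≡-Reasoning

  s₀-s₂-commuteˡ : ∀ x → s₀ (s₂ (inj₁ x)) ≡ s₂ (s₀ (inj₁ x))
  s₀-s₂-commuteˡ x with oldLabel P x in found
  ... | just (d , e) = begin
    inj₂ (B.s₀ (labelFlag P′ (emap d , e)))         ≡⟨ cong inj₂ (LB.s₀-labelFlag (emap d , e)) ⟩
    inj₂ (labelFlag P′ (emap d , flipEnd e))        ≡⟨ s₂-labelled (A.s₀ x) found₀ ⟨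
    s₂ (inj₁ (A.s₀ x))                              ∎
    where
    open ≡-Reasoning
    found₀ : oldLabel P (A.s₀ x) ≡ just (d , flipEnd e)
    found₀ = trans (cong (oldLabel P ∘ A.s₀) (LA.oldLabel-just x found))
                   (trans (cong (oldLabel P) (LA.s₀-labelFlag (d , e))) (LA.oldLabel-labelFlag _))
  ... | nothing = begin
    inj₁ (A.s₀ (A.s₂ x))   ≡⟨ cong inj₁ (IA.comm₀₂ x) ⟩
    inj₁ (A.s₂ (A.s₀ x))   ≡⟨ s₂-unlabelled (A.s₀ x) (LA.oldLabel-s₀-nothing x found) ⟨
    s₂ (inj₁ (A.s₀ x))     ∎
    where open ≡-Reasoning

  σ : Flag → Flag
  σ = ρ Γ#Γ′

  startˡ startʳ : Dir → Flag
  startˡ d = inj₁ (labelFlag P (d , tl))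
  startʳ e = inj₂ (labelFlag P′ (e , tl))

  endˡ endʳ : Dir → Flag
  endˡ d = inj₁ (labelFlag P (d , hd))
  endʳ e = inj₂ (labelFlag P′ (e , hd))

  rev-startˡ : ∀ d → rev Γ#Γ′ (startˡ d) ≡ endʳ (emap d)
  rev-startˡ d = trans (cong s₀ (s₂-labelled _ (LA.oldLabel-labelFlag (d , tl))))
                       (cong inj₂ (LB.s₀-labelFlag (emap d , tl)))

  rev-startʳ : ∀ e → rev Γ#Γ′ (startʳ e) ≡ endˡ (emap⁻ e)
  rev-startʳ e = trans (cong s₀ (s₂-labelledʳ _ (LB.oldLabel-labelFlag (e , tl))))
                       (cong inj₁ (LA.s₀-labelFlag (emap⁻ e , tl)))

  Interiorˡ : Flag → Set
  Interiorˡ z = ∃[ x ] (z ≡ inj₁ x × oldLabel P x ≡ nothing)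

  private
    ρNP : NP.Flag → NP.Flag
    ρNP = ρ (NP P)

    -- the state s₂ (d , tl) of N_P(Γ) from which IsZMonodromy follows the zigzag
    startNP : Dir → NP.Flag
    startNP d = inj₁ (labelFlag P (d , tl))

    σ-follows-ρNP : ∀ x → labelOf P (ρNP (inj₁ x)) ≡ nothing →
                    ∃[ x′ ] (σ (inj₁ x) ≡ inj₁ x′ × ρNP (inj₁ x) ≡ inj₁ x′)
    σ-follows-ρNP x unlabelled with oldLabel P (A.s₁ (A.s₀ x))
    ... | nothing = _ , refl , refl   -- no clause for just l: then unlabelled : just l ≡ nothing

    σ-exits : ∀ x {d′} → labelOf P (ρNP (inj₁ x)) ≡ just (d′ , tl) → σ (inj₁ x) ≡ startʳ (emap d′)
    σ-exits x hit with oldLabel P (A.s₁ (A.s₀ x)) in found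
    ... | just _  with refl ← hit = refl
    ... | nothing with () ← trans (sym hit) (LA.oldLabel-s₂-nothing _ found)

    σ-tracks-ρNP : ∀ d n → (∀ j → 1 ≤ j → j < n → labelOf P (iter ρNP j (startNP d)) ≡ nothing) →
                   ∀ j → j < n → ∃[ x ] (iter σ j (startˡ d) ≡ inj₁ x × iter ρNP j (startNP d) ≡ inj₁ x)
    σ-tracks-ρNP d n unlabelled zero    j<n = _ , refl , refl
    σ-tracks-ρNP d n unlabelled (suc j) j<n
      with x , σʲ≡ , ρʲ≡ ← σ-tracks-ρNP d n unlabelled j (≤-trans (n≤1+n (suc j)) j<n)
      with x′ , σ≡ , ρ≡ ← σ-follows-ρNP x (subst (λ z → labelOf P (ρNP z) ≡ nothing) ρʲ≡
                                                 (unlabelled (suc j) (s≤s z≤n) j<n)) =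
      x′ , trans (cong σ σʲ≡) σ≡ , trans (cong ρNP ρʲ≡) ρ≡

  crossing : ∀ {M} → IsZMonodromy P M → ∀ d →
             ∃[ n ] (1 ≤ n × iter σ n (startˡ d) ≡ startʳ (emap (M d))
                           × (∀ j → 1 ≤ j → j < n → Interiorˡ (iter σ j (startˡ d))))
  crossing {M} hM d with hM d
  ... | suc m , _ , exit , unlabelled with x , σᵐ≡ , ρᵐ≡ ← σ-tracks-ρNP d (suc m) unlabelled m ≤-refl =
    suc m , s≤s z≤n ,
    trans (cong σ σᵐ≡) (σ-exits x (subst (λ z → labelOf P (ρNP z) ≡ just (M d , tl)) ρᵐ≡ exit)) ,
    interior
    where
    interior : ∀ j → 1 ≤ j → j < suc m → Interiorˡ (iter σ j (startˡ d))
    interior j 1≤j j<n with x , σʲ≡ , ρʲ≡ ← σ-tracks-ρNP d (suc m) unlabelled j j<n =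
      x , σʲ≡ , subst (λ z → labelOf P z ≡ nothing) ρʲ≡ (unlabelled j 1≤j j<n)

inverse : SpecialHom → SpecialHom
inverse g = record
  { vmap = vmap⁻ ; vmap⁻ = vmap ; vmap-inv₁ = vmap-inv₂ ; vmap-inv₂ = vmap-inv₁
  ; emap = emap⁻ ; emap⁻ = emap ; emap-inv₁ = emap-inv₂ ; emap-inv₂ = emap-inv₁
  ; tail-pres = λ d → preserves tailV tail-pres d
  ; head-pres = λ d → preserves headV head-pres d
  }
  where
  open SpecialHom g
  preserves : ∀ (end : Dir → BV) → (∀ d → vmap (end d) ≡ end (emap d)) →
              ∀ d → vmap⁻ (end d) ≡ end (emap⁻ d)
  preserves end pres d = begin
    vmap⁻ (end d)                  ≡⟨ cong (vmap⁻ ∘ end) (emap-inv₂ d) ⟨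
    vmap⁻ (end (emap (emap⁻ d)))   ≡⟨ cong vmap⁻ (pres (emap⁻ d)) ⟨
    vmap⁻ (vmap (end (emap⁻ d)))   ≡⟨ vmap-inv₁ _ ⟩
    end (emap⁻ d)                  ∎
    where open ≡-Reasoning

module ConnectedSum {G G′ : PreGem} {τ : PreGem.Flag G → Bool} {τ′ : PreGem.Flag G′ → Bool}
                    (gem : IsGem G) (gem′ : IsGem G′)
                    (P : SpecialPair G τ) (P′ : SpecialPair G′ τ′) (g : SpecialHom) where
  private
    module IA = IsGem gem
    module IB = IsGem gem′
    -- Γ′ #_{g⁻¹} Γ, which swap identifies with Γ #_g Γ′
    module R = GluedLeft gem′ gem P′ P (inverse g)
  open GluedLeft gem gem′ P P′ g public
  open ≡-Reasoning

  s₀-swap : ∀ z → s₀ (swap z) ≡ swap (R.s₀ z)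
  s₀-swap (inj₁ _) = refl
  s₀-swap (inj₂ _) = refl

  s₁-swap : ∀ z → s₁ (swap z) ≡ swap (R.s₁ z)
  s₁-swap (inj₁ _) = refl
  s₁-swap (inj₂ _) = refl

  s₂-swap : ∀ z → s₂ (swap z) ≡ swap (R.s₂ z)
  s₂-swap (inj₁ y) with oldLabel P′ y
  ... | just _  = refl
  ... | nothing = refl
  s₂-swap (inj₂ x) with oldLabel P x
  ... | just _  = refl
  ... | nothing = refl

  s₀-involutive : ∀ z → s₀ (s₀ z) ≡ z
  s₀-involutive (inj₁ x) = cong inj₁ (IA.inv₀ x)
  s₀-involutive (inj₂ y) = cong inj₂ (IB.inv₀ y)

  s₁-involutive : ∀ z → s₁ (s₁ z) ≡ z
  s₁-involutive (inj₁ x) = cong inj₁ (IA.inv₁ x)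
  s₁-involutive (inj₂ y) = cong inj₂ (IB.inv₁ y)

  s₂-involutive : ∀ z → s₂ (s₂ z) ≡ z
  s₂-involutive (inj₁ x) = s₂-involutiveˡ x
  s₂-involutive (inj₂ y) = begin
    s₂ (s₂ (swap (inj₁ y)))     ≡⟨ cong s₂ (s₂-swap (inj₁ y)) ⟩
    s₂ (swap (R.s₂ (inj₁ y)))   ≡⟨ s₂-swap (R.s₂ (inj₁ y)) ⟩
    swap (R.s₂ (R.s₂ (inj₁ y))) ≡⟨ cong swap (R.s₂-involutiveˡ y) ⟩
    inj₂ y                      ∎

  s₀-s₂-commute : ∀ z → s₀ (s₂ z) ≡ s₂ (s₀ z)
  s₀-s₂-commute (inj₁ x) = s₀-s₂-commuteˡ x
  s₀-s₂-commute (inj₂ y) = begin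
    s₀ (s₂ (swap (inj₁ y)))        ≡⟨ cong s₀ (s₂-swap (inj₁ y)) ⟩
    s₀ (swap (R.s₂ (inj₁ y)))      ≡⟨ s₀-swap (R.s₂ (inj₁ y)) ⟩
    swap (R.s₀ (R.s₂ (inj₁ y)))    ≡⟨ cong swap (R.s₀-s₂-commuteˡ y) ⟩
    swap (R.s₂ (R.s₀ (inj₁ y)))    ≡⟨ s₂-swap (R.s₀ (inj₁ y)) ⟨
    s₂ (s₀ (inj₂ y))               ∎

  private
    involution-injective : ∀ (s : Flag → Flag) → (∀ z → s (s z) ≡ z) → Injective _≡_ _≡_ s
    involution-injective s inv {z} {w} eq = trans (sym (inv z)) (trans (cong s eq) (inv w))

  σ-injective : Injective _≡_ _≡_ σ
  σ-injective = involution-injective s₀ s₀-involutive ∘ involution-injective s₁ s₁-involutive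
              ∘ involution-injective s₂ s₂-involutive

  rev-involutive : ∀ z → rev Γ#Γ′ (rev Γ#Γ′ z) ≡ z
  rev-involutive z = begin
    s₀ (s₂ (s₀ (s₂ z))) ≡⟨ cong s₀ (s₀-s₂-commute (s₂ z)) ⟨
    s₀ (s₀ (s₂ (s₂ z))) ≡⟨ s₀-involutive (s₂ (s₂ z)) ⟩
    s₂ (s₂ z)           ≡⟨ s₂-involutive z ⟩
    z                   ∎

  σ-rev-σ : ∀ z → σ (rev Γ#Γ′ (σ z)) ≡ rev Γ#Γ′ z
  σ-rev-σ z = begin
    s₂ (s₁ (s₀ (s₀ (s₂ (s₂ (s₁ (s₀ z))))))) ≡⟨ cong (s₂ ∘ s₁) (s₀-involutive (s₂ (s₂ (s₁ (s₀ z))))) ⟩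
    s₂ (s₁ (s₂ (s₂ (s₁ (s₀ z)))))           ≡⟨ cong (s₂ ∘ s₁) (s₂-involutive (s₁ (s₀ z))) ⟩
    s₂ (s₁ (s₁ (s₀ z)))                     ≡⟨ cong s₂ (s₁-involutive (s₀ z)) ⟩
    s₂ (s₀ z)                               ≡⟨ s₀-s₂-commute z ⟨
    s₀ (s₂ z)                               ∎

  open ReversibleDynamics σ (rev Γ#Γ′) σ-injective rev-involutive σ-rev-σ public

  iter-σ-swap : ∀ n z → iter σ n (swap z) ≡ swap (iter R.σ n z)
  iter-σ-swap zero    z = refl
  iter-σ-swap (suc n) z = begin
    σ (iter σ n (swap z))                  ≡⟨ cong σ (iter-σ-swap n z) ⟩
    s₂ (s₁ (s₀ (swap (iter R.σ n z))))     ≡⟨ cong (s₂ ∘ s₁) (s₀-swap (iter R.σ n z)) ⟩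
    s₂ (s₁ (swap (R.s₀ (iter R.σ n z))))   ≡⟨ cong s₂ (s₁-swap (R.s₀ (iter R.σ n z))) ⟩
    s₂ (swap (R.s₁ (R.s₀ (iter R.σ n z)))) ≡⟨ s₂-swap (R.s₁ (R.s₀ (iter R.σ n z))) ⟩
    swap (R.σ (iter R.σ n z))              ∎

  Interiorʳ : Flag → Set
  Interiorʳ z = ∃[ y ] (z ≡ inj₂ y × oldLabel P′ y ≡ nothing)

  crossingʳ : ∀ {M′} → IsZMonodromy P′ M′ → ∀ e →
              ∃[ n ] (1 ≤ n × iter σ n (startʳ e) ≡ startˡ (SpecialHom.emap⁻ g (M′ e))
                            × (∀ j → 1 ≤ j → j < n → Interiorʳ (iter σ j (startʳ e))))
  crossingʳ hM′ e with n , 1≤n , exit , interior ← R.crossing hM′ e =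
    n , 1≤n , trans (iter-σ-swap n (R.startˡ e)) (cong swap exit) ,
    λ j 1≤j j<n → swapped j (interior j 1≤j j<n)
    where
    swapped : ∀ j → R.Interiorˡ (iter R.σ j (R.startˡ e)) → Interiorʳ (iter σ j (startʳ e))
    swapped j (y , at , unlabelled) = y , trans (iter-σ-swap j (R.startˡ e)) (cong swap at) , unlabelled

module ZigzagCount {G G′ : PreGem} {τ : PreGem.Flag G → Bool} {τ′ : PreGem.Flag G′ → Bool}
                   (gem : IsGem G) (gem′ : IsGem G′)
                   (P : SpecialPair G τ) (P′ : SpecialPair G′ τ′) (g : SpecialHom)
                   {M M′ : Dir → Dir} (hM : IsZMonodromy P M) (hM′ : IsZMonodromy P′ M′) where
  open ConnectedSum gem gem′ P P′ g
  open SpecialHom g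
  private
    module LA = EdgeFlags.Labels G gem P
    module LB = EdgeFlags.Labels G′ gem′ P′
  open ≡-Reasoning

  π : Dir → Dir
  π = emap⁻ ∘ M′ ∘ emap ∘ M

  startˡ-injective : Injective _≡_ _≡_ startˡ
  startˡ-injective eq = cong proj₁ (LA.labelFlag-injective (_ , tl) (_ , tl) (inj₁-injective eq))

  Between : Flag → Set
  Between z = (∀ d → ¬ z ≡ startˡ d) × (∀ e → ¬ z ≡ endʳ e)

  interiorˡ-between : ∀ {z} → Interiorˡ z → Between z
  interiorˡ-between (x , refl , unlabelled) =
    (λ d eq → LA.labelFlag-labelled (d , tl)
                (subst (λ w → oldLabel P w ≡ nothing) (inj₁-injective eq) unlabelled)) ,
    (λ e ())

  interiorʳ-between : ∀ {z} → Interiorʳ z → Between z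
  interiorʳ-between (y , refl , unlabelled) =
    (λ d ()) ,
    (λ e eq → LB.labelFlag-labelled (e , hd)
                (subst (λ w → oldLabel P′ w ≡ nothing) (inj₂-injective eq) unlabelled))

  startʳ-between : ∀ e → Between (startʳ e)
  startʳ-between e′ =
    (λ d ()) , λ e eq → tl≢hd (cong proj₂ (LB.labelFlag-injective (e′ , tl) (e , hd) (inj₂-injective eq)))
    where
    tl≢hd : ¬ tl ≡ hd
    tl≢hd ()

  roundTrip : ∀ d → ∃[ N ] (1 ≤ N × iter σ N (startˡ d) ≡ startˡ (π d)
                                   × (∀ j → 1 ≤ j → j < N → Between (iter σ j (startˡ d))))
  roundTrip d
    with n , 1≤n , crossed , insideˡ ← crossing hM d
    with n′ , _ , returned , insideʳ ← crossingʳ hM′ (emap (M d)) =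
    n′ + n , ≤-trans 1≤n (m≤n+m n n′) ,
    trans (iter-+ σ n′ n (startˡ d)) (trans (cong (iter σ n′) crossed) returned) ,
    iter-concat σ {Q = Between} n n′ crossed (startʳ-between (emap (M d)))
                (λ j 1≤j j<n → interiorˡ-between (insideˡ j 1≤j j<n))
                (λ j 1≤j j<n′ → interiorʳ-between (insideʳ j 1≤j j<n′))

  tripLength : Dir → ℕ
  tripLength d = proj₁ (roundTrip d)

  tripLength-positive : ∀ d → 1 ≤ tripLength d
  tripLength-positive d = proj₁ (proj₂ (roundTrip d))

  trip-returns : ∀ d → iter σ (tripLength d) (startˡ d) ≡ startˡ (π d)
  trip-returns d = proj₁ (proj₂ (proj₂ (roundTrip d)))

  trip-between : ∀ d j → 1 ≤ j → j < tripLength d → Between (iter σ j (startˡ d))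
  trip-between d = proj₂ (proj₂ (proj₂ (roundTrip d)))

  iterate-within-trip : ∀ m d → ∃[ k ] ∃[ r ] (r < tripLength (iter π k d)
                                              × iter σ m (startˡ d) ≡ iter σ r (startˡ (iter π k d)))
  iterate-within-trip zero    d = 0 , 0 , tripLength-positive d , refl
  iterate-within-trip (suc m) d with k , r , r<N , at ← iterate-within-trip m d
    with m≤n⇒m<n∨m≡n r<N
  ...   | inj₁ r+1<N = k , suc r , r+1<N , cong σ at
  ...   | inj₂ r+1≡N = suc k , 0 , tripLength-positive _ , (begin
    σ (iter σ m (startˡ d))                                ≡⟨ cong σ at ⟩
    iter σ (suc r) (startˡ (iter π k d))                   ≡⟨ cong (λ i → iter σ i (startˡ (iter π k d))) r+1≡N ⟩
    iter σ (tripLength (iter π k d)) (startˡ (iter π k d)) ≡⟨ trip-returns (iter π k d) ⟩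
    startˡ (iter π (suc k) d)                              ∎)

  within-trip-start : ∀ {d d′} r → r < tripLength d → iter σ r (startˡ d) ≡ startˡ d′ → d ≡ d′
  within-trip-start zero    _   eq = startˡ-injective eq
  within-trip-start {d} {d′} (suc r) r<N eq = ⊥-elim (proj₁ (trip-between d (suc r) (s≤s z≤n) r<N) d′ eq)

  iterate-start : ∀ m {d d′} → iter σ m (startˡ d) ≡ startˡ d′ → ∃[ k ] (iter π k d ≡ d′)
  iterate-start m {d} eq with k , r , r<N , at ← iterate-within-trip m d =
    k , within-trip-start r r<N (trans (sym at) eq)

  iterate-not-end : ∀ m d e → ¬ iter σ m (startˡ d) ≡ endʳ e
  iterate-not-end m d e eq with iterate-within-trip m d
  ... | k , zero  , _   , at with () ← trans (sym at) eq
  ... | k , suc r , r<N , at = proj₂ (trip-between (iter π k d) (suc r) (s≤s z≤n) r<N) e (trans (sym at) eq)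

  private
    earlier-trip : ∀ {d₁ d₂} → π d₁ ≡ π d₂ → tripLength d₁ ≤ tripLength d₂ → d₁ ≡ d₂
    earlier-trip {d₁} {d₂} eq N₁≤N₂ =
      sym (within-trip-start (N₂ ∸ N₁) (∸-monoʳ-< (tripLength-positive d₁) N₁≤N₂)
                             (iter-injective σ-injective N₁ shifted))
      where
      N₁ = tripLength d₁
      N₂ = tripLength d₂
      shifted : iter σ N₁ (iter σ (N₂ ∸ N₁) (startˡ d₂)) ≡ iter σ N₁ (startˡ d₁)
      shifted = begin
        iter σ N₁ (iter σ (N₂ ∸ N₁) (startˡ d₂)) ≡⟨ iter-+ σ N₁ (N₂ ∸ N₁) (startˡ d₂) ⟨
        iter σ (N₁ + (N₂ ∸ N₁)) (startˡ d₂)      ≡⟨ cong (λ i → iter σ i (startˡ d₂)) (m+[n∸m]≡n N₁≤N₂) ⟩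
        iter σ N₂ (startˡ d₂)                    ≡⟨ trip-returns d₂ ⟩
        startˡ (π d₂)                            ≡⟨ cong startˡ eq ⟨
        startˡ (π d₁)                            ≡⟨ trip-returns d₁ ⟨
        iter σ N₁ (startˡ d₁)                    ∎

  π-injective : Injective _≡_ _≡_ π
  π-injective {d₁} {d₂} eq with ≤-total (tripLength d₁) (tripLength d₂)
  ... | inj₁ N₁≤N₂ = earlier-trip eq N₁≤N₂
  ... | inj₂ N₂≤N₁ = sym (earlier-trip (sym eq) N₂≤N₁)

  M-surjective : ∀ d′ → ∃[ d ] (M d ≡ d′)
  M-surjective d′ with iter-period (π-injective ∘ cong (emap⁻ ∘ M′ ∘ emap)) d′
  ... | suc p , _ , _ , period = iter M p d′ , period

  trip-iterate : ∀ k d → ∃[ m ] (k ≤ m × iter σ m (startˡ d) ≡ startˡ (iter π k d))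
  trip-iterate zero    d = 0 , z≤n , refl
  trip-iterate (suc k) d with m , k≤m , at ← trip-iterate k d =
    tripLength (iter π k d) + m , +-mono-≤ (tripLength-positive (iter π k d)) k≤m ,
    trans (iter-+ σ (tripLength (iter π k d)) m (startˡ d))
          (trans (cong (iter σ (tripLength (iter π k d))) at) (trip-returns (iter π k d)))

  startˡ-periodic : ∀ d → Periodic (startˡ d)
  startˡ-periodic d with p , 1≤p , _ , period ← iter-period π-injective d
    with trip-iterate p d
  ... | suc m , _ , at = m , trans at (cong startˡ period)
  ... | zero , p≤0 , _ with () ← ≤-trans 1≤p p≤0

  open CycleRepresentatives π

  distinct-cycles⇒distinct-zigzags : ∀ {r s} → ¬ SameCycle r s → ¬ SameZigzag Γ#Γ′ (startˡ r) (startˡ s)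
  distinct-cycles⇒distinct-zigzags {r} {s} different (n , inj₁ forward)
    with k , πᵏ ← iterate-start n {r} {s} forward = different (sameCycle-complete π-injective k πᵏ)
  distinct-cycles⇒distinct-zigzags {r} {s} _ (n , inj₂ backward) =
    let k , at = orbit-backwards (startˡ-periodic s) n 0 backward
    in iterate-not-end k s (emap r) (trans at (rev-startˡ r))

  glued-flag-on-trip : ∀ y → OnGluedEdges P P′ g y →
                       ∃[ d ] (Orbit (startˡ d) y ⊎ Orbit (rev Γ#Γ′ (startˡ d)) y)
  glued-flag-on-trip (inj₁ x) glued with oldLabel P x in found
  ... | nothing = ⊥-elim (glued refl)
  ... | just (d , tl) = d , inj₁ (0 , cong inj₁ (sym (LA.oldLabel-just x found)))
  ... | just (d′ , hd) with d , refl ← M-surjective d′ with n , _ , crossed , _ ← crossing hM d =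
    let k , atRev = rev-orbit (startˡ-periodic d) n
    in d , inj₂ (k , (begin
      iter σ k (rev Γ#Γ′ (startˡ d)) ≡⟨ atRev ⟩
      rev Γ#Γ′ (iter σ n (startˡ d)) ≡⟨ cong (rev Γ#Γ′) crossed ⟩
      rev Γ#Γ′ (startʳ (emap (M d))) ≡⟨ rev-startʳ (emap (M d)) ⟩
      endˡ (emap⁻ (emap (M d)))      ≡⟨ cong endˡ (emap-inv₁ (M d)) ⟩
      endˡ (M d)                     ≡⟨ cong inj₁ (LA.oldLabel-just x found) ⟨
      inj₁ x                         ∎))
  glued-flag-on-trip (inj₂ y) glued with oldLabel P′ y in found
  ... | nothing = ⊥-elim (glued refl)
  ... | just (e , hd) =
    emap⁻ e , inj₂ (0 , trans (rev-startˡ (emap⁻ e))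
                              (trans (cong endʳ (emap-inv₂ e)) (cong inj₂ (sym (LB.oldLabel-just y found)))))
  ... | just (e , tl) with d , M≡ ← M-surjective (emap⁻ e) with n , _ , crossed , _ ← crossing hM d =
    d , inj₁ (n , trans crossed (trans (cong (startʳ ∘ emap) M≡)
                                (trans (cong startʳ (emap-inv₂ e)) (cong inj₂ (sym (LB.oldLabel-just y found))))))

  zigzagCount : HasZigzagCount Γ#Γ′ (OnGluedEdges P P′ g) (numCycles π)
  zigzagCount = record
    { reps     = map startˡ (cycleReps allDirs [])
    ; len      = trans (length-map startˡ (cycleReps allDirs [])) length-cycleReps-allDirs
    ; pass     = Allₚ.map⁺ {f = startˡ} (All.tabulate {xs = cycleReps allDirs []} (λ {r} _ → start-passes r))
    ; distinct = AllPairsₚ.map⁺ {f = startˡ} (AllPairs.map (λ {r} {s} → distinct-cycles⇒distinct-zigzags {r} {s})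
                                                           (cycleReps-distinct allDirs []))
    ; cover    = covered
    }
    where
    start-passes : ∀ r → PassesThrough Γ#Γ′ (OnGluedEdges P P′ g) (startˡ r)
    start-passes r = startˡ r , (0 , inj₁ refl) , LA.labelFlag-labelled (r , tl)

    covered : ∀ x → PassesThrough Γ#Γ′ (OnGluedEdges P P′ g) x →
              Any (λ r → SameZigzag Γ#Γ′ r x) (map startˡ (cycleReps allDirs []))
    covered x (y , x~y , glued) with d , onTrip ← glued-flag-on-trip y glued =
      Anyₚ.map⁺ {f = startˡ} (Any.map (λ {r} → via-cycle {r}) (cycleReps-covers-all d))
      where
      d~x : SameZigzag Γ#Γ′ (startˡ d) x
      d~x = sameOrbitUpToRev-periodic (startˡ-periodic d) x~y onTrip
      via-cycle : ∀ {r} → SameCycle r d → SameZigzag Γ#Γ′ (startˡ r) x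
      via-cycle {r} same with j , πʲ ← sameCycle-sound π same with m , _ , at ← trip-iterate j r =
        sameOrbitUpToRev-orbit (startˡ-periodic r) (m , trans at (cong startˡ πʲ)) d~x

lemma4 : (Γ Γ' : PreGem)
           (τ : PreGem.Flag Γ → Bool) (τ' : PreGem.Flag Γ' → Bool)
           → IsTriangulation Γ → IsTriangulation Γ'
           → IsZHomogeneous Γ τ → IsZHomogeneous Γ' τ'
           → (P : SpecialPair Γ τ) (P' : SpecialPair Γ' τ')
           → NoEdgeJoiningEnds Γ τ P ⊎ NoEdgeJoiningEnds Γ' τ' P'
           → (M : Dir → Dir) → IsZMonodromy P M
           → (M' : Dir → Dir) → IsZMonodromy P' M'
           → (g : SpecialHom)
           → HasZigzagCount (ConnSum P P' g) (OnGluedEdges P P' g)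
               (numCycles (SpecialHom.emap⁻ g ∘ M' ∘ SpecialHom.emap g ∘ M))
-- Only the gem structure of Γ and Γ′ enters the count.
lemma4 Γ Γ' τ τ' tri tri' _ _ P P' _ M hM M' hM' g =
  ZigzagCount.zigzagCount (IsTriangulation.isGem tri) (IsTriangulation.isGem tri') P P' g hM hM'
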